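{- Let $d<N$ be positive integers. (1) Let $Q_d=\left(d^{(\lfloor N/d\rfloor)},\,N-d\lfloor N/d\rfloor\right)$. Then for every partition $Q=(n_1,\dots,n_r)$ of $N$ with all parts of size at most $d$, one has $\sigma_i(Q)\le\sigma_i(Q_d)$ for all $i$. (2) Assume $N\ge 2d$ and let \[ Q'_d=\begin{cases}\left(d^{(\lfloor N/d\rfloor-1)},\,d-1,\,N-d\lfloor N/d\rfloor+1\right) & N\not\equiv -1\pmod d,\\ \left(d^{(\lfloor N/d\rfloor-1)},\,d-1,\,d-1,\,1\right) & N\equiv -1\pmod d.\end{cases} \] Then for every partition $Q=(n_1,\dots,n_r)$ of $N$ with all parts of size at most $d$ and at most $\lfloor N/d\rfloor-1$ parts of size $d$, one has $\sigma_i(Q)\le\sigma_i(Q'_d)$ for all $i$.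
   Context: Notation $a^{(k)}$ means $a$ repeated $k$ times; parts equal to $0$ are ignored. For a partition $Q=(n_1,\dots,n_r)$ of $N$, let $m_i=\lfloor n_i/2\rfloor$ and let $\Xi(Q)=(\chi_j(Q))_j$ be the concatenation over $i$ with $m_i\ne0$ of the lists $(n_i-1,n_i-3,\dots,n_i-2m_i+1)$, reordered to be decreasing, with $\chi_j(Q)=0$ for $j$ beyond its length. Define $\sigma_i(Q)=\sum_{k\le i}\chi_k(Q)$. (Equivalently, $\sigma_i(Q)=\sigma_i(B)$ for a bipartition $B=((p_k,q_k))_k$ with $p_k+q_k=n_k$ and $|p_k-q_k|\le1$, where $\sigma_i(B)$ is defined by the same recipe with $m_k=\min(p_k,q_k)$.) -}

module Defs where

open import Data.Nat using (ℕ; zero; suc; _+_; _*_; _∸_; _≤_; _≟_; NonZero)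
open import Data.Nat.DivMod using (_/_; _%_)
open import Data.Nat.Properties using (≤-decTotalOrder)
open import Data.List using (List; []; _∷_; _++_; map; upTo; concatMap; reverse; take; replicate; length; filter)
open import Data.Nat.ListAction using (sum)
open import Data.List.Relation.Unary.All using (All)
open import Data.Product using (_×_)
open import Relation.Nullary using (yes; no)
open import Data.List.Sort.InsertionSort ≤-decTotalOrder using (sort)

oddChain : ℕ → List ℕ
oddChain n = map (λ k → n ∸ 1 ∸ 2 * k) (upTo (n / 2))

Ξ : List ℕ → List ℕ
Ξ Q = reverse (sort (concatMap oddChain Q))

σ : ℕ → List ℕ → ℕ
σ i Q = sum (take i (Ξ Q))

IsPartitionBounded : ℕ → ℕ → List ℕ → Set
IsPartitionBounded N d Q = All (λ n → 1 ≤ n × n ≤ d) Q × sum Q ≡ N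
  where open import Relation.Binary.PropositionalEquality using (_≡_)

countParts : ℕ → List ℕ → ℕ
countParts d Q = length (filter (_≟ d) Q)

-- Q_d = (d^(⌊N/d⌋), N - d⌊N/d⌋)   (a zero part is harmless: it contributes nothing to Ξ)
Qd : (N d : ℕ) → .{{NonZero d}} → List ℕ
Qd N d = replicate (N / d) d ++ (N ∸ d * (N / d) ∷ [])

-- Q'_d, case split on whether N ≡ -1 (mod d), i.e. d ∣ N + 1
Q'd : (N d : ℕ) → .{{NonZero d}} → List ℕ
Q'd N d with (suc N) % d ≟ 0
... | no  _ = replicate (N / d ∸ 1) d ++ (d ∸ 1 ∷ N ∸ d * (N / d) + 1 ∷ [])
... | yes _ = replicate (N / d ∸ 1) d ++ (d ∸ 1 ∷ d ∸ 1 ∷ 1 ∷ [])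

-- σ i Q is the sum of the i largest entries of Ξ Q, and for a decreasing list that sum is
-- the minimum over thresholds t of i * t + Σ (x ∸ t). It therefore suffices to compare the
-- excesses Σ (x ∸ t) over Ξ Q, which add up over the parts n of Q to h_t n = Σ_k (n - 1 - 2k ∸ t).
-- Each h_t is convex with h_t 0 = 0, and for such a function the sum over parts of size at most e
-- is largest on the greedy partition (e, …, e, remainder): by an exchange argument, adding a part
-- n ≤ e to the greedy partition of M gives at most the greedy partition of M + n. For (2) the
-- parts equal to d are set aside and the rest is packed greedily into blocks of size d - 1; a part
-- d is worth at least the d units it adds to such a packing, so the parts d that Q lacks can be
-- added back, giving Q'_d.
module Submission where

open import Data.Empty using (⊥-elim)
open import Data.List
  using (List; []; _∷_; _++_; map; concatMap; reverse; take; upTo; applyUpTo; replicate; length)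
open import Data.List.Properties
  using (map-++; map-id; map-cong; map-applyUpTo; unfold-reverse; filter-accept; filter-reject)
open import Data.List.Relation.Binary.Permutation.Propositional
  using (_↭_; ↭-refl; ↭-sym; ↭-trans; prep)
open import Data.List.Relation.Binary.Permutation.Propositional.Properties
  using (↭-reverse; All-resp-↭; map⁺; shift)
open import Data.List.Relation.Unary.All using (All; []; _∷_)
import Data.List.Relation.Unary.All as All
open import Data.List.Relation.Unary.AllPairs using (AllPairs; []; _∷_)
import Data.List.Relation.Unary.AllPairs.Properties as AllPairs
open import Data.List.Relation.Unary.Linked.Properties using (Linked⇒AllPairs)
open import Data.Nat
  using (ℕ; zero; suc; _+_; _*_; _∸_; _≤_; _<_; _≥_; _≟_; _≤?_; z≤n; s≤s; s≤s⁻¹; z<s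
        ; NonZero; >-nonZero; >-nonZero⁻¹)
open import Data.Nat.Divisibility using (n∣m*n)
open import Data.Nat.DivMod
  using (_/_; _%_; n/1≡n; m/n≡1+[m∸n]/n; m≡m%n+[m/n]*n; m%n≡m∸m/n*n; +-distrib-/-∣ˡ; m*n/n≡m
        ; m<n⇒m/n≡0; m≥n⇒m/n>0; %-remove-+ˡ; m<n⇒m%n≡m; m%n<n; [m+kn]%n≡m%n; n%n≡0; %-pred-≡0)
open import Data.Nat.ListAction using (sum)
open import Data.Nat.ListAction.Properties using (sum-++; sum-↭)
open import Data.Nat.Properties
open import Algebra.Properties.CommutativeSemigroup +-commutativeSemigroup
  using (interchange; x∙yz≈y∙xz; x∙yz≈y∙zx; x∙yz≈zx∙y; x∙yz≈z∙xy; xy∙z≈y∙xz; xy∙z≈y∙zx)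
open import Data.List.Sort.InsertionSort.Properties ≤-decTotalOrder using (sort-↭; sort-↗)
open import Data.Nat.Tactic.RingSolver using (solve-∀)
open import Data.Product using (∃; _×_; _,_; proj₂)
open import Data.Sum using (inj₁; inj₂)
open import Defs
open import Function using (_∘_; id)
open import Relation.Binary.PropositionalEquality
  using (_≡_; _≢_; refl; sym; trans; cong; cong₂; subst; subst₂; module ≡-Reasoning)
open import Relation.Nullary using (yes; no; ¬_)

excess : ℕ → List ℕ → ℕ
excess t xs = sum (map (_∸ t) xs)

excess-++ : ∀ t xs ys → excess t (xs ++ ys) ≡ excess t xs + excess t ys
excess-++ t xs ys = trans (cong sum (map-++ (_∸ t) xs ys)) (sum-++ (map (_∸ t) xs) _)

excess-↭ : ∀ t {xs ys} → xs ↭ ys → excess t xs ≡ excess t ys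
excess-↭ t p = sum-↭ (map⁺ (_∸ t) p)

All≤⇒excess≡0 : ∀ {t xs} → All (_≤ t) xs → excess t xs ≡ 0
All≤⇒excess≡0 [] = refl
All≤⇒excess≡0 (x≤t ∷ xs≤t) = cong₂ _+_ (m≤n⇒m∸n≡0 x≤t) (All≤⇒excess≡0 xs≤t)

Descending : List ℕ → Set
Descending = AllPairs _≥_

-- For a decreasing list, sum (take i xs) is the minimum over t of i * t + excess t xs,
-- attained at t = the i-th entry.
sum-take≤ : ∀ i t xs → sum (take i xs) ≤ i * t + excess t xs
sum-take≤ zero t xs = z≤n
sum-take≤ (suc i) t [] = z≤n
sum-take≤ (suc i) t (x ∷ xs) = begin
  x + sum (take i xs)                        ≤⟨ +-mono-≤ (m≤n+m∸n x t) (sum-take≤ i t xs) ⟩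
  (t + (x ∸ t)) + (i * t + excess t xs)      ≡⟨ interchange t (x ∸ t) (i * t) (excess t xs) ⟩
  (t + i * t) + ((x ∸ t) + excess t xs)      ∎
  where open ≤-Reasoning

sum-take-attained : ∀ {xs} → Descending xs → ∀ i → ∃ λ t → i * t + excess t xs ≤ sum (take i xs)
sum-take-attained [] zero = 0 , z≤n
sum-take-attained [] (suc i) = 0 , ≤-reflexive (trans (+-identityʳ (suc i * 0)) (*-zeroʳ (suc i)))
sum-take-attained {x ∷ xs} (x≥xs ∷ _) zero = x , ≤-reflexive (cong₂ _+_ (n∸n≡0 x) (All≤⇒excess≡0 x≥xs))
sum-take-attained {x ∷ xs} (x≥xs ∷ desc) (suc i) with sum-take-attained desc i
... | t , bound with t ≤? x
...   | yes t≤x = t , (begin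
  (t + i * t) + ((x ∸ t) + excess t xs)  ≡⟨ interchange t (i * t) (x ∸ t) (excess t xs) ⟩
  (t + (x ∸ t)) + (i * t + excess t xs)  ≡⟨ cong (_+ (i * t + excess t xs)) (m+[n∸m]≡n t≤x) ⟩
  x + (i * t + excess t xs)              ≤⟨ +-monoʳ-≤ x bound ⟩
  x + sum (take i xs)                    ∎)
  where open ≤-Reasoning
...   | no t≰x = x , (begin
  (x + i * x) + ((x ∸ x) + excess x xs)
    ≡⟨ cong ((x + i * x) +_) (cong₂ _+_ (n∸n≡0 x) (All≤⇒excess≡0 x≥xs)) ⟩
  (x + i * x) + 0                        ≡⟨ +-identityʳ _ ⟩
  x + i * x                              ≤⟨ +-monoʳ-≤ x (*-monoʳ-≤ i (<⇒≤ (≰⇒> t≰x))) ⟩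
  x + i * t                              ≤⟨ +-monoʳ-≤ x (≤-trans (m≤m+n (i * t) _) bound) ⟩
  x + sum (take i xs)                    ∎)
  where open ≤-Reasoning

excess≤⇒sum-take≤ : ∀ {xs ys} → Descending ys → (∀ t → excess t xs ≤ excess t ys) →
                    ∀ i → sum (take i xs) ≤ sum (take i ys)
excess≤⇒sum-take≤ {xs} desc excess≤ i with sum-take-attained desc i
... | t , attained = ≤-trans (sum-take≤ i t xs) (≤-trans (+-monoʳ-≤ (i * t) (excess≤ t)) attained)

reverse-descending : ∀ {xs} → AllPairs _≤_ xs → Descending (reverse xs)
reverse-descending [] = []
reverse-descending {x ∷ xs} (x≤xs ∷ ascending) rewrite unfold-reverse x xs =
  AllPairs.++⁺ (reverse-descending ascending) ([] ∷ [])
    (All.map (_∷ []) (All-resp-↭ (↭-sym (↭-reverse xs)) x≤xs))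

Ξ-descending : ∀ Q → Descending (Ξ Q)
Ξ-descending Q = reverse-descending (Linked⇒AllPairs ≤-trans (sort-↗ (concatMap oddChain Q)))

chainExcess : ℕ → ℕ → ℕ
chainExcess t n = excess t (oddChain n)

excess-concatMap-oddChain : ∀ t Q → excess t (concatMap oddChain Q) ≡ sum (map (chainExcess t) Q)
excess-concatMap-oddChain t [] = refl
excess-concatMap-oddChain t (n ∷ Q) =
  trans (excess-++ t (oddChain n) _) (cong (chainExcess t n +_) (excess-concatMap-oddChain t Q))

excess-Ξ : ∀ t Q → excess t (Ξ Q) ≡ sum (map (chainExcess t) Q)
excess-Ξ t Q = trans (excess-↭ t (↭-trans (↭-reverse _) (sort-↭ (concatMap oddChain Q))))
                     (excess-concatMap-oddChain t Q)

σ-mono : ∀ Q R → (∀ t → sum (map (chainExcess t) Q) ≤ sum (map (chainExcess t) R)) →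
         ∀ i → σ i Q ≤ σ i R
σ-mono Q R dominated = excess≤⇒sum-take≤ (Ξ-descending R)
  (λ t → subst₂ _≤_ (sym (excess-Ξ t Q)) (sym (excess-Ξ t R)) (dominated t))

oddChain-suc-suc : ∀ n → oddChain (2 + n) ≡ suc n ∷ oddChain n
oddChain-suc-suc n = begin
  map g (upTo ((2 + n) / 2))        ≡⟨ cong (map g ∘ upTo) (m/n≡1+[m∸n]/n {2 + n} (s≤s (s≤s z≤n))) ⟩
  suc n ∷ map g (applyUpTo suc m)   ≡⟨ cong (suc n ∷_) (map-applyUpTo suc g m) ⟩
  suc n ∷ applyUpTo (g ∘ suc) m     ≡⟨ cong (suc n ∷_) (sym (map-applyUpTo id (g ∘ suc) m)) ⟩
  suc n ∷ map (g ∘ suc) (upTo m)    ≡⟨ cong (suc n ∷_) (map-cong g-suc (upTo m)) ⟩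
  suc n ∷ oddChain n                ∎
  where
  open ≡-Reasoning
  g : ℕ → ℕ
  g k = 2 + n ∸ 1 ∸ 2 * k
  m = n / 2
  g-suc : ∀ k → g (suc k) ≡ n ∸ 1 ∸ 2 * k
  g-suc k = trans (cong (suc n ∸_) (*-suc 2 k)) (sym (∸-+-assoc n 1 (2 * k)))

chainExcess-suc-suc : ∀ t n → chainExcess t (2 + n) ≡ (suc n ∸ t) + chainExcess t n
chainExcess-suc-suc t n = cong (excess t) (oddChain-suc-suc n)

-- f (x + 1) - f x ≤ f (y + 1) - f y for x ≤ y, stated without subtraction.
Convex : (ℕ → ℕ) → Set
Convex f = ∀ {x y} → x ≤ y → f (suc x) + f y ≤ f x + f (suc y)

∸-convex : ∀ t → Convex (_∸ t)
∸-convex zero {x} {y} _ = ≤-reflexive (sym (+-suc x y))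
∸-convex (suc t) {zero} {y} _ rewrite 0∸n≡0 t = ∸-monoʳ-≤ y (n≤1+n t)
∸-convex (suc t) {suc x} {suc y} (s≤s x≤y) = ∸-convex t x≤y

chainExcess-mono : ∀ t n → chainExcess t n ≤ chainExcess t (suc n)
chainExcess-mono t zero = z≤n
chainExcess-mono t (suc zero) = z≤n
chainExcess-mono t (suc (suc n))
  rewrite chainExcess-suc-suc t n | chainExcess-suc-suc t (suc n) =
  +-mono-≤ (∸-monoˡ-≤ t (n≤1+n (suc n))) (chainExcess-mono t n)

chainExcess-convex-at-1 : ∀ t y → (1 ∸ t) + chainExcess t (suc y) ≤ chainExcess t (2 + y)
chainExcess-convex-at-1 t zero = ≤-refl
chainExcess-convex-at-1 zero (suc zero) = ≤-refl
chainExcess-convex-at-1 (suc zero) (suc zero) = z≤n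
chainExcess-convex-at-1 (suc (suc t)) (suc zero) = z≤n
chainExcess-convex-at-1 t (suc (suc y))
  rewrite chainExcess-suc-suc t (suc y) | chainExcess-suc-suc t (suc (suc y)) = begin
  (1 ∸ t) + ((2 + y ∸ t) + f (suc y))  ≡⟨ x∙yz≈y∙xz (1 ∸ t) (2 + y ∸ t) (f (suc y)) ⟩
  (2 + y ∸ t) + ((1 ∸ t) + f (suc y))
    ≤⟨ +-mono-≤ (∸-monoˡ-≤ t (n≤1+n (2 + y))) (chainExcess-convex-at-1 t y) ⟩
  (3 + y ∸ t) + f (2 + y)              ∎
  where
  open ≤-Reasoning
  f = chainExcess t

chainExcess-convex : ∀ t → Convex (chainExcess t)
chainExcess-convex t {zero} {y} _ = chainExcess-mono t y
chainExcess-convex t {suc zero} {suc y} _ =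
  ≤-trans (≤-reflexive (cong (_+ chainExcess t (suc y)) (+-identityʳ (1 ∸ t)))) (chainExcess-convex-at-1 t y)
chainExcess-convex t {suc (suc x)} {suc (suc y)} (s≤s (s≤s x≤y))
  rewrite chainExcess-suc-suc t (suc x) | chainExcess-suc-suc t x
        | chainExcess-suc-suc t (suc y) | chainExcess-suc-suc t y = begin
  ((2 + x ∸ t) + f (suc x)) + ((suc y ∸ t) + f y)   ≡⟨ interchange (2 + x ∸ t) _ _ _ ⟩
  ((2 + x ∸ t) + (suc y ∸ t)) + (f (suc x) + f y)
    ≤⟨ +-mono-≤ (∸-convex t (s≤s x≤y)) (chainExcess-convex t x≤y) ⟩
  ((suc x ∸ t) + (2 + y ∸ t)) + (f x + f (suc y))   ≡⟨ interchange (suc x ∸ t) _ _ _ ⟩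
  ((suc x ∸ t) + f x) + ((2 + y ∸ t) + f (suc y))   ∎
  where
  open ≤-Reasoning
  f = chainExcess t

-- Σ f over the partition (e, …, e, M % e) of M into ⌊M / e⌋ parts e and a remainder.
greedy : (ℕ → ℕ) → (e : ℕ) → .{{NonZero e}} → ℕ → ℕ
greedy f e M = M / e * f e + f (M % e)

division-identity : ∀ M e .{{_ : NonZero e}} → M ≡ M / e * e + M % e
division-identity M e = trans (m≡m%n+[m/n]*n M e) (+-comm (M % e) _)

m∸n*[m/n]≡m%n : ∀ m n .{{_ : NonZero n}} → m ∸ n * (m / n) ≡ m % n
m∸n*[m/n]≡m%n m n = trans (cong (m ∸_) (*-comm n (m / n))) (sym (m%n≡m∸m/n*n m n))

suc[m%n]≡n⇒suc[m]%n≡0 : ∀ m n .{{_ : NonZero n}} → suc (m % n) ≡ n → suc m % n ≡ 0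
suc[m%n]≡n⇒suc[m]%n≡0 m n suc[m%n]≡n = begin
  suc m % n                       ≡⟨ cong (λ z → suc z % n) (m≡m%n+[m/n]*n m n) ⟩
  (suc (m % n) + m / n * n) % n   ≡⟨ [m+kn]%n≡m%n (suc (m % n)) (m / n) n ⟩
  suc (m % n) % n                 ≡⟨ cong (_% n) suc[m%n]≡n ⟩
  n % n                           ≡⟨ n%n≡0 n ⟩
  0                               ∎
  where open ≡-Reasoning

sum-map-replicate-++ : ∀ (f : ℕ → ℕ) k x ys → sum (map f (replicate k x ++ ys)) ≡ k * f x + sum (map f ys)
sum-map-replicate-++ f zero x ys = refl
sum-map-replicate-++ f (suc k) x ys =
  trans (cong (f x +_) (sum-map-replicate-++ f k x ys)) (sym (+-assoc (f x) _ _))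

Qd-value : ∀ f N d .{{_ : NonZero d}} → sum (map f (Qd N d)) ≡ greedy f d N
Qd-value f N d = trans (sum-map-replicate-++ f (N / d) d _)
  (cong (N / d * f d +_) (trans (+-identityʳ _) (cong f (m∸n*[m/n]≡m%n N d))))

countParts-self : ∀ d Q → countParts d (d ∷ Q) ≡ suc (countParts d Q)
countParts-self d Q = cong length (filter-accept (_≟ d) {x = d} {xs = Q} refl)

countParts-other : ∀ {d n} Q → n ≢ d → countParts d (n ∷ Q) ≡ countParts d Q
countParts-other Q n≢d = cong length (filter-reject (_≟ _) {xs = Q} n≢d)

countParts-split : ∀ {e Q} → All (_≤ suc e) Q →
  ∃ λ R → All (_≤ e) R × Q ↭ replicate (countParts (suc e) Q) (suc e) ++ R
countParts-split [] = [] , [] , ↭-refl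
countParts-split {e} {n ∷ Q} (n≤d ∷ Q≤d) with countParts-split Q≤d | n ≟ suc e
... | R , R≤e , Q↭ | yes refl rewrite countParts-self (suc e) Q = R , R≤e , prep (suc e) Q↭
... | R , R≤e , Q↭ | no n≢d rewrite countParts-other Q n≢d =
  n ∷ R , s≤s⁻¹ (≤∧≢⇒< n≤d n≢d) ∷ R≤e ,
  ↭-trans (prep n Q↭) (↭-sym (shift n (replicate (countParts (suc e) Q) (suc e)) R))

module ConvexFunction {f : ℕ → ℕ} (convex : Convex f) (f0 : f 0 ≡ 0) where

  convex-shift : ∀ {x y} → x ≤ y → ∀ s → f (x + s) + f y ≤ f x + f (y + s)
  convex-shift {x} {y} x≤y zero rewrite +-identityʳ x | +-identityʳ y = ≤-refl
  convex-shift {x} {y} x≤y (suc s) rewrite +-suc x s | +-suc y s =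
    +-cancelʳ-≤ (fxs + fys) _ _ (begin
      (f (suc (x + s)) + f y) + (fxs + fys)  ≡⟨ rearrange (f (suc (x + s))) (f y) fxs fys ⟩
      (f (suc (x + s)) + fys) + (fxs + f y)  ≤⟨ +-mono-≤ (convex (+-monoˡ-≤ s x≤y)) (convex-shift x≤y s) ⟩
      (fxs + f (suc (y + s))) + (f x + fys)  ≡⟨ rearrange′ fxs (f (suc (y + s))) (f x) fys ⟩
      (f x + f (suc (y + s))) + (fxs + fys)  ∎)
    where
    open ≤-Reasoning
    fxs = f (x + s)
    fys = f (y + s)
    rearrange : ∀ a b c d → (a + b) + (c + d) ≡ (a + d) + (c + b)
    rearrange = solve-∀
    rearrange′ : ∀ a b c d → (a + b) + (c + d) ≡ (c + b) + (a + d)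
    rearrange′ = solve-∀

  superadditive : ∀ a b → f a + f b ≤ f (a + b)
  superadditive a b = begin
    f a + f b        ≤⟨ convex-shift z≤n a ⟩
    f 0 + f (b + a)  ≡⟨ cong₂ _+_ f0 (cong f (+-comm b a)) ⟩
    f (a + b)        ∎
    where open ≤-Reasoning

  module _ (e : ℕ) .{{_ : NonZero e}} where

    greedy-packing : ∀ q {r} → r < e → greedy f e (q * e + r) ≡ q * f e + f r
    greedy-packing q {r} r<e = cong₂ (λ a b → a * f e + f b) quotient remainder
      where
      open ≡-Reasoning
      quotient : (q * e + r) / e ≡ q
      quotient = begin
        (q * e + r) / e    ≡⟨ +-distrib-/-∣ˡ r (n∣m*n q) ⟩
        q * e / e + r / e  ≡⟨ cong₂ _+_ (m*n/n≡m q e) (m<n⇒m/n≡0 r<e) ⟩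
        q + 0              ≡⟨ +-identityʳ q ⟩
        q                  ∎
      remainder : (q * e + r) % e ≡ r
      remainder = trans (%-remove-+ˡ r (n∣m*n q)) (m<n⇒m%n≡m r<e)

    -- r = e is allowed because f 0 ≡ 0.
    greedy-packing≤ : ∀ q {r} → r ≤ e → greedy f e (q * e + r) ≡ q * f e + f r
    greedy-packing≤ q r≤e with m≤n⇒m<n∨m≡n r≤e
    ... | inj₁ r<e = greedy-packing q r<e
    ... | inj₂ refl = begin
      greedy f e (q * e + e)        ≡⟨ cong (greedy f e) (trans (+-comm (q * e) e) (sym (+-identityʳ _))) ⟩
      greedy f e (suc q * e + 0)    ≡⟨ greedy-packing (suc q) (>-nonZero⁻¹ e) ⟩
      (f e + q * f e) + f 0         ≡⟨ cong ((f e + q * f e) +_) f0 ⟩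
      (f e + q * f e) + 0           ≡⟨ trans (+-identityʳ _) (+-comm (f e) (q * f e)) ⟩
      q * f e + f e                 ∎
      where open ≡-Reasoning

    greedy-zero : greedy f e 0 ≡ 0
    greedy-zero = trans (greedy-packing≤ 0 z≤n) f0

    greedy-step-packing : ∀ q {r n} → r < e → n ≤ e → f n + (q * f e + f r) ≤ greedy f e (q * e + r + n)
    greedy-step-packing q {r} {n} r<e n≤e with r + n ≤? e
    ... | yes r+n≤e = begin
      f n + (q * f e + f r)         ≡⟨ x∙yz≈y∙zx (f n) (q * f e) (f r) ⟩
      q * f e + (f r + f n)         ≤⟨ +-monoʳ-≤ (q * f e) (superadditive r n) ⟩
      q * f e + f (r + n)           ≡⟨ sym (greedy-packing≤ q r+n≤e) ⟩
      greedy f e (q * e + (r + n))  ≡⟨ cong (greedy f e) (sym (+-assoc (q * e) r n)) ⟩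
      greedy f e (q * e + r + n)    ∎
      where open ≤-Reasoning
    -- Otherwise r + n = e + x with x ≤ r, and convexity trades f n + f r for f e + f x.
    ... | no r+n≰e with m≤n⇒∃[o]m+o≡n (<⇒≤ r<e)
    ...   | u , r+u≡e
      with m≤n⇒∃[o]m+o≡n (+-cancelˡ-≤ r u n (subst (_≤ r + n) (sym r+u≡e) (<⇒≤ (≰⇒> r+n≰e))))
    ...   | x , refl = begin
      f (u + x) + (q * f e + f r)   ≡⟨ x∙yz≈y∙xz (f (u + x)) (q * f e) (f r) ⟩
      q * f e + (f (u + x) + f r)   ≤⟨ +-monoʳ-≤ (q * f e) exchange ⟩
      q * f e + (f x + f e)         ≡⟨ x∙yz≈zx∙y (q * f e) (f x) (f e) ⟩
      suc q * f e + f x             ≡⟨ sym (greedy-packing (suc q) (≤-<-trans x≤r r<e)) ⟩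
      greedy f e (suc q * e + x)    ≡⟨ cong (greedy f e) (sym mass) ⟩
      greedy f e (q * e + r + (u + x))  ∎
      where
      open ≤-Reasoning
      x≤r : x ≤ r
      x≤r = +-cancelˡ-≤ u x r (subst (u + x ≤_) (trans (sym r+u≡e) (+-comm r u)) n≤e)
      exchange : f (u + x) + f r ≤ f x + f e
      exchange = subst₂ (λ a b → f a + f r ≤ f x + f b) (+-comm x u) r+u≡e (convex-shift x≤r u)
      mass : q * e + r + (u + x) ≡ suc q * e + x
      mass = begin-equality
        q * e + r + (u + x)      ≡⟨ regroup (q * e) r u x ⟩
        (r + u) + q * e + x      ≡⟨ cong (λ z → z + q * e + x) r+u≡e ⟩
        e + q * e + x            ∎
        where
        regroup : ∀ a b c d → a + b + (c + d) ≡ (b + c) + a + d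
        regroup = solve-∀

    greedy-step : ∀ M {n} → n ≤ e → f n + greedy f e M ≤ greedy f e (M + n)
    greedy-step M {n} n≤e = subst (λ M′ → f n + greedy f e M ≤ greedy f e (M′ + n))
      (sym (division-identity M e)) (greedy-step-packing (M / e) (m%n<n M e) n≤e)

    greedy-bound : ∀ {Q} → All (_≤ e) Q → ∀ M → sum (map f Q) + greedy f e M ≤ greedy f e (M + sum Q)
    greedy-bound [] M = ≤-reflexive (cong (greedy f e) (sym (+-identityʳ M)))
    greedy-bound {n ∷ Q} (n≤e ∷ Q≤e) M = begin
      (f n + sum (map f Q)) + greedy f e M  ≡⟨ xy∙z≈y∙xz (f n) _ _ ⟩
      sum (map f Q) + (f n + greedy f e M)  ≤⟨ +-monoʳ-≤ (sum (map f Q)) (greedy-step M n≤e) ⟩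
      sum (map f Q) + greedy f e (M + n)    ≤⟨ greedy-bound Q≤e (M + n) ⟩
      greedy f e (M + n + sum Q)            ≡⟨ cong (greedy f e) (+-assoc M n (sum Q)) ⟩
      greedy f e (M + (n + sum Q))          ∎
      where open ≤-Reasoning

    sum-map≤greedy : ∀ {Q} → All (_≤ e) Q → sum (map f Q) ≤ greedy f e (sum Q)
    sum-map≤greedy {Q} Q≤e = begin
      sum (map f Q)                 ≡⟨ sym (+-identityʳ _) ⟩
      sum (map f Q) + 0             ≡⟨ cong (sum (map f Q) +_) (sym greedy-zero) ⟩
      sum (map f Q) + greedy f e 0  ≤⟨ greedy-bound Q≤e 0 ⟩
      greedy f e (sum Q)            ∎
      where open ≤-Reasoning

    greedy-grow : ∀ M → greedy f e (suc e + M) ≤ f (suc e) + greedy f e M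
    greedy-grow M = begin
      greedy f e (suc e + M)                ≡⟨ cong (greedy f e) mass ⟩
      greedy f e (suc q * e + suc r)        ≡⟨ greedy-packing≤ (suc q) r<e ⟩
      (f e + q * f e) + f (suc r)           ≡⟨ xy∙z≈y∙zx (f e) (q * f e) (f (suc r)) ⟩
      q * f e + (f (suc r) + f e)           ≤⟨ +-monoʳ-≤ (q * f e) (convex (<⇒≤ r<e)) ⟩
      q * f e + (f r + f (suc e))           ≡⟨ x∙yz≈z∙xy (q * f e) (f r) (f (suc e)) ⟩
      f (suc e) + greedy f e M              ∎
      where
      open ≤-Reasoning
      q = M / e
      r = M % e
      r<e : r < e
      r<e = m%n<n M e
      mass : suc e + M ≡ suc q * e + suc r
      mass = begin-equality
        suc e + M                ≡⟨ cong (suc e +_) (division-identity M e) ⟩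
        suc e + (q * e + r)      ≡⟨ regroup e (q * e) r ⟩
        (e + q * e) + suc r      ∎
        where
        regroup : ∀ a b c → suc a + (b + c) ≡ (a + b) + suc c
        regroup = solve-∀

    greedy-grow* : ∀ k M → greedy f e (k * suc e + M) ≤ k * f (suc e) + greedy f e M
    greedy-grow* zero M = ≤-refl
    greedy-grow* (suc k) M = begin
      greedy f e ((suc e + k * suc e) + M)        ≡⟨ cong (greedy f e) (+-assoc (suc e) (k * suc e) M) ⟩
      greedy f e (suc e + (k * suc e + M))        ≤⟨ greedy-grow (k * suc e + M) ⟩
      f (suc e) + greedy f e (k * suc e + M)      ≤⟨ +-monoʳ-≤ (f (suc e)) (greedy-grow* k M) ⟩
      f (suc e) + (k * f (suc e) + greedy f e M)  ≡⟨ sym (+-assoc (f (suc e)) _ _) ⟩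
      (f (suc e) + k * f (suc e)) + greedy f e M  ∎
      where open ≤-Reasoning

  Qd-dominates : ∀ d .{{_ : NonZero d}} {Q} → All (_≤ d) Q → sum (map f Q) ≤ sum (map f (Qd (sum Q) d))
  Qd-dominates d Q≤d = subst (_ ≤_) (sym (Qd-value f _ d)) (sum-map≤greedy d Q≤d)

  Q'd-value : ∀ N e .{{_ : NonZero e}} →
    sum (map f (Q'd N (suc e))) ≡ (N / suc e ∸ 1) * f (suc e) + greedy f e (suc e + N % suc e)
  Q'd-value N e with (suc N) % suc e ≟ 0
  ... | no suc[N]%d≢0 =
    trans (sum-map-replicate-++ f (N / d ∸ 1) d _) (cong ((N / d ∸ 1) * f d +_) tail)
    where
    open ≡-Reasoning
    d = suc e
    r = N % d
    r<e : r < e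
    r<e = ≤∧≢⇒< (s≤s⁻¹ (m%n<n N d)) (suc[N]%d≢0 ∘ suc[m%n]≡n⇒suc[m]%n≡0 N d ∘ cong suc)
    tail : f e + (f (N ∸ d * (N / d) + 1) + 0) ≡ greedy f e (d + r)
    tail = begin
      f e + (f (N ∸ d * (N / d) + 1) + 0)  ≡⟨ cong (λ z → f e + (f (z + 1) + 0)) (m∸n*[m/n]≡m%n N d) ⟩
      f e + (f (r + 1) + 0)                ≡⟨ regroup (f e) (f (r + 1)) ⟩
      1 * f e + f (r + 1)                  ≡⟨ sym (greedy-packing≤ e 1 (subst (_≤ e) (+-comm 1 r) r<e)) ⟩
      greedy f e (1 * e + (r + 1))         ≡⟨ cong (greedy f e) (regroup′ e r) ⟩
      greedy f e (d + r)                   ∎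
      where
      regroup : ∀ a b → a + (b + 0) ≡ 1 * a + b
      regroup = solve-∀
      regroup′ : ∀ a b → 1 * a + (b + 1) ≡ suc a + b
      regroup′ = solve-∀
  ... | yes suc[N]%d≡0 =
    trans (sum-map-replicate-++ f (N / d ∸ 1) d _) (cong ((N / d ∸ 1) * f d +_) tail)
    where
    open ≡-Reasoning
    d = suc e
    tail : f e + (f e + (f 1 + 0)) ≡ greedy f e (d + N % d)
    tail = begin
      f e + (f e + (f 1 + 0))   ≡⟨ regroup (f e) (f 1) ⟩
      2 * f e + f 1             ≡⟨ sym (greedy-packing≤ e 2 (>-nonZero⁻¹ e)) ⟩
      greedy f e (2 * e + 1)    ≡⟨ cong (greedy f e) (regroup′ e) ⟩
      greedy f e (d + e)        ≡⟨ cong (λ z → greedy f e (d + z)) (sym (%-pred-≡0 suc[N]%d≡0)) ⟩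
      greedy f e (d + N % d)    ∎
      where
      regroup : ∀ a b → a + (a + (b + 0)) ≡ 2 * a + b
      regroup = solve-∀
      regroup′ : ∀ a → 2 * a + 1 ≡ suc a + a
      regroup′ = solve-∀

  Q'd-dominates : ∀ e .{{_ : NonZero e}} {Q} → All (_≤ suc e) Q → suc e ≤ sum Q →
    countParts (suc e) Q ≤ sum Q / suc e ∸ 1 → sum (map f Q) ≤ sum (map f (Q'd (sum Q) (suc e)))
  Q'd-dominates e {Q} Q≤d d≤N c≤q′ with countParts-split Q≤d
  ... | R , R≤e , Q↭ = begin
    sum (map f Q)                           ≡⟨ split f ⟩
    c * f d + sum (map f R)                 ≤⟨ +-monoʳ-≤ (c * f d) (sum-map≤greedy e R≤e) ⟩
    c * f d + greedy f e (sum R)            ≡⟨ cong (λ z → c * f d + greedy f e z) sum-R ⟩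
    c * f d + greedy f e (k * d + (d + r))  ≤⟨ +-monoʳ-≤ (c * f d) (greedy-grow* e k (d + r)) ⟩
    c * f d + (k * f d + rest)              ≡⟨ sym (+-assoc (c * f d) (k * f d) rest) ⟩
    (c * f d + k * f d) + rest              ≡⟨ cong (_+ rest) (sym (*-distribʳ-+ (f d) c k)) ⟩
    (c + k) * f d + rest                    ≡⟨ cong (λ z → z * f d + rest) c+k≡q′ ⟩
    q′ * f d + rest                         ≡⟨ sym (Q'd-value N e) ⟩
    sum (map f (Q'd N d))                   ∎
    where
    open ≤-Reasoning
    N = sum Q
    d = suc e
    r = N % d
    q′ = N / d ∸ 1
    c = countParts d Q
    k = q′ ∸ c
    rest = greedy f e (d + r)
    q≢0 : NonZero (N / d)
    q≢0 = >-nonZero (m≥n⇒m/n>0 d≤N)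
    c+k≡q′ : c + k ≡ q′
    c+k≡q′ = m+[n∸m]≡n c≤q′
    split : ∀ g → sum (map g Q) ≡ c * g d + sum (map g R)
    split g = trans (sum-↭ (map⁺ g Q↭)) (sum-map-replicate-++ g c d R)
    N≡cd+ΣR : N ≡ c * d + sum R
    N≡cd+ΣR = subst₂ (λ xs ys → sum xs ≡ c * d + sum ys) (map-id Q) (map-id R) (split id)
    sum-R : sum R ≡ k * d + (d + r)
    sum-R = +-cancelˡ-≡ (c * d) _ _ (begin-equality
      c * d + sum R            ≡⟨ sym N≡cd+ΣR ⟩
      N                        ≡⟨ division-identity N d ⟩
      N / d * d + r            ≡⟨ cong (λ z → z * d + r) (sym (suc-pred (N / d) {{q≢0}})) ⟩
      suc q′ * d + r           ≡⟨ cong (λ z → suc z * d + r) (sym c+k≡q′) ⟩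
      suc (c + k) * d + r      ≡⟨ regroup c k d r ⟩
      c * d + (k * d + (d + r)) ∎)
      where
      regroup : ∀ c k d r → suc (c + k) * d + r ≡ c * d + (k * d + (d + r))
      regroup = solve-∀

σ-dominated-by-Qd : ∀ d .{{_ : NonZero d}} N (Q : List ℕ) → IsPartitionBounded N d Q →
  ∀ i → σ i Q ≤ σ i (Qd N d)
σ-dominated-by-Qd d _ Q (parts , refl) = σ-mono Q (Qd (sum Q) d) λ t →
  ConvexFunction.Qd-dominates (chainExcess-convex t) refl d (All.map proj₂ parts)

σ-dominated-by-Q'd : ∀ e .{{_ : NonZero e}} N (Q : List ℕ) → IsPartitionBounded N (suc e) Q →
  suc e ≤ N → countParts (suc e) Q ≤ N / suc e ∸ 1 → ∀ i → σ i Q ≤ σ i (Q'd N (suc e))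
σ-dominated-by-Q'd e _ Q (parts , refl) d≤N c≤q′ = σ-mono Q (Q'd (sum Q) (suc e)) λ t →
  ConvexFunction.Q'd-dominates (chainExcess-convex t) refl e (All.map proj₂ parts) d≤N c≤q′

countParts-ones : ∀ {Q} → All (λ n → 1 ≤ n × n ≤ 1) Q → countParts 1 Q ≡ sum Q
countParts-ones [] = refl
countParts-ones {.1 ∷ Q} ((s≤s z≤n , s≤s z≤n) ∷ ones) =
  trans (countParts-self 1 Q) (cong suc (countParts-ones ones))

countParts-ones-too-many : ∀ N (Q : List ℕ) → IsPartitionBounded N 1 Q → 0 < N → ¬ countParts 1 Q ≤ N / 1 ∸ 1
countParts-ones-too-many _ Q (parts , refl) 0<N c≤ = <⇒≱ (∸-monoʳ-< z<s 0<N)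
  (subst₂ _≤_ (countParts-ones parts) (cong (_∸ 1) (n/1≡n (sum Q))) c≤)

lemma12p13 : (d N : ℕ) → (0<d : 0 < d) → d < N →
    let instance _ = >-nonZero 0<d in
    ((Q : List ℕ) → IsPartitionBounded N d Q → (i : ℕ) → σ i Q ≤ σ i (Qd N d))
    × (2 * d ≤ N → (Q : List ℕ) → IsPartitionBounded N d Q → countParts d Q ≤ N / d ∸ 1 →
        (i : ℕ) → σ i Q ≤ σ i (Q'd N d))
-- Part (2) only needs d < N, not 2 d ≤ N; for d = 1 its hypotheses are contradictory.
lemma12p13 (suc zero) N _ 1<N = σ-dominated-by-Qd 1 N , λ _ Q partition c≤q′ →
  ⊥-elim (countParts-ones-too-many N Q partition (<-trans z<s 1<N) c≤q′)
lemma12p13 (suc (suc e)) N _ d<N = σ-dominated-by-Qd (2 + e) N , λ _ Q partition c≤q′ →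
  σ-dominated-by-Q'd (suc e) N Q partition (<⇒≤ d<N) c≤q′
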